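{- Let $D$ be a bidirected graph and let $f: V(D) \to \mathbb{N}_0$ be a function. Then $D$ is DP-$f$-colorable if and only if its underlying undirected graph $G(D)$ is DP-$f$-colorable.
   Context: Digraphs are finite, without loops and without parallel arcs, but two opposite arcs $uv$ and $vu$ between the same pair of vertices are allowed. A bidirected graph is a digraph obtained from a simple undirected graph by replacing each edge by two opposite arcs. The underlying graph $G(D)$ of a digraph $D$ is the simple graph on $V(D)$ in which $u,v$ are adjacent iff at least one of $uv, vu$ is an arc of $D$. A cover of a digraph $D$ is a pair $(X,H)$ where $X$ assigns to each $v \in V(D)$ a set $X_v$, the sets $X_v$ being pairwise disjoint, and $H$ is a digraph with $V(H)=\bigcup_{v} X_v$ such that each $X_v$ is independent in $H$, for each arc $a=uv \in A(D)$ the arcs of $H$ from $X_u$ to $X_v$ form a (possibly empty) matching $M_a$, and $A(H)=\bigcup_{a\in A(D)} M_a$. A transversal is a set $T\subseteq V(H)$ with $|T\cap X_v|=1$ for all $v$; it is acyclic if $H[T]$ contains no directed cycle. $D$ is $(X,H)$-colorable if $(X,H)$ has an acyclic transversal, and $D$ is DP-$f$-colorable if $D$ is $(X,H)$-colorable for every cover $(X,H)$ with $|X_v|\ge f(v)$ for all $v$. For a simple undirected graph $G$, a cover $(X,H)$ is defined analogously with $H$ an undirected graph, each $X_v$ independent, for each edge $uv$ the edges of $H$ between $X_u$ and $X_v$ forming a (possibly empty) matching, and $E(H)$ the union of these matchings; $G$ is $(X,H)$-colorable if there is a transversal $T$ with $H[T]$ edgeless, and DP-$f$-colorable if it is $(X,H)$-colorable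 for every cover with $|X_v|\ge f(v)$ for all $v$. -}

module Defs where

open import Data.Nat using (ℕ; _≤_)
open import Data.Fin using (Fin)
open import Data.List using (List; []; _∷_; length; last)
open import Data.List.Relation.Unary.Unique.Propositional using (Unique)
open import Data.Maybe using (just)
open import Data.Product using (Σ; _×_; _,_; ∃)
open import Data.Sum using (_⊎_; inj₁; inj₂)
open import Data.Empty using (⊥)
open import Data.Unit using (⊤)
open import Relation.Binary.PropositionalEquality using (_≡_)
open import Relation.Nullary using (¬_)

-- A (finite) digraph: no loops; at most one arc uv for each ordered
-- pair (arcs are given by a relation); opposite arcs are allowed.
record Digraph : Set₁ where
  field
    n        : ℕ
    Arc      : Fin n → Fin n → Set
    loopless : ∀ v → ¬ Arc v v
open Digraph public

record Graph : Set₁ where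
  field
    n      : ℕ
    Adj    : Fin n → Fin n → Set
    irrefl : ∀ v → ¬ Adj v v
    sym    : ∀ {u v} → Adj u v → Adj v u
open Graph public

-- D is bidirected: obtained from a simple graph by replacing each edge by
-- two opposite arcs, i.e. every arc has its opposite arc.
IsBidirected : Digraph → Set
IsBidirected D = ∀ {u v} → Arc D u v → Arc D v u

swap⊎ : {A B : Set} → A ⊎ B → B ⊎ A
swap⊎ (inj₁ a) = inj₂ a
swap⊎ (inj₂ b) = inj₁ b

underlying : Digraph → Graph
underlying D = record
  { n      = n D
  ; Adj    = λ u v → Arc D u v ⊎ Arc D v u
  ; irrefl = λ v → λ { (inj₁ a) → loopless D v a ; (inj₂ a) → loopless D v a }
  ; sym    = swap⊎
  }

DirPath : ∀ {m} → (Fin m → Fin m → Set) → List (Fin m) → Set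
DirPath R []             = ⊤
DirPath R (x ∷ [])       = ⊤
DirPath R (x ∷ y ∷ rest) = R x y × DirPath R (y ∷ rest)

IsDirCycle : ∀ {m} → (Fin m → Fin m → Set) → List (Fin m) → Set
IsDirCycle R []       = ⊥
IsDirCycle R (x ∷ xs) =
  (2 ≤ length (x ∷ xs)) × Unique (x ∷ xs) × DirPath R (x ∷ xs)
  × Σ (Fin _) (λ y → (last (x ∷ xs) ≡ just y) × R y x)

HasDirCycle : ∀ {m} → (Fin m → Fin m → Set) → Set
HasDirCycle R = Σ (List _) (IsDirCycle R)

-- Covers.  X_v is represented by Fin (size v); the vertex set of H is the
-- disjoint union Σ v. Fin (size v), so the X_v are pairwise disjoint.

record DiCover (D : Digraph) : Set₁ where
  field
    size : Fin (n D) → ℕ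
    HArc : Σ (Fin (n D)) (λ v → Fin (size v)) → Σ (Fin (n D)) (λ v → Fin (size v)) → Set
    H-loopless  : ∀ p → ¬ HArc p p
    independent : ∀ v (x y : Fin (size v)) → ¬ HArc (v , x) (v , y)
    arcs-over   : ∀ u v (x : Fin (size u)) (y : Fin (size v)) →
                  HArc (u , x) (v , y) → Arc D u v
    matching-out : ∀ u v (x : Fin (size u)) (y y′ : Fin (size v)) → Arc D u v →
                   HArc (u , x) (v , y) → HArc (u , x) (v , y′) → y ≡ y′
    matching-in  : ∀ u v (x x′ : Fin (size u)) (y : Fin (size v)) → Arc D u v →
                   HArc (u , x) (v , y) → HArc (u , x′) (v , y) → x ≡ x′
open DiCover public

-- Transversal T: one vertex t v ∈ X_v for every v.  H[T] is acyclic iff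
-- the induced digraph (transported to V(D) via v ↦ (v , t v)) has no
-- directed cycle.
AcyclicTransversal : ∀ {D} → (C : DiCover D) → ((v : Fin (n D)) → Fin (DiCover.size C v)) → Set
AcyclicTransversal {D} C t =
  ¬ HasDirCycle (λ u v → HArc C (u , t u) (v , t v))

DiColorable : (D : Digraph) → DiCover D → Set
DiColorable D C = Σ ((v : Fin (n D)) → Fin (size C v)) (AcyclicTransversal C)

DP-f-colorableᴰ : (D : Digraph) → (Fin (n D) → ℕ) → Set₁
DP-f-colorableᴰ D f =
  (C : DiCover D) → (∀ v → f v ≤ DiCover.size C v) → DiColorable D C

record Cover (G : Graph) : Set₁ where
  field
    size : Fin (n G) → ℕ
    HAdj : Σ (Fin (n G)) (λ v → Fin (size v)) → Σ (Fin (n G)) (λ v → Fin (size v)) → Set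
    H-irrefl    : ∀ p → ¬ HAdj p p
    H-sym       : ∀ {p q} → HAdj p q → HAdj q p
    independent : ∀ v (x y : Fin (size v)) → ¬ HAdj (v , x) (v , y)
    edges-over  : ∀ u v (x : Fin (size u)) (y : Fin (size v)) →
                  HAdj (u , x) (v , y) → Adj G u v
    matching-l  : ∀ u v (x : Fin (size u)) (y y′ : Fin (size v)) → Adj G u v →
                  HAdj (u , x) (v , y) → HAdj (u , x) (v , y′) → y ≡ y′
    matching-r  : ∀ u v (x x′ : Fin (size u)) (y : Fin (size v)) → Adj G u v →
                  HAdj (u , x) (v , y) → HAdj (u , x′) (v , y) → x ≡ x′
open Cover public

Colorable : (G : Graph) → Cover G → Set
Colorable G C = Σ ((v : Fin (n G)) → Fin (Cover.size C v))
  (λ t → ∀ u v → ¬ HAdj C (u , t u) (v , t v))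

DP-f-colorable : (G : Graph) → (Fin (n G) → ℕ) → Set₁
DP-f-colorable G f =
  (C : Cover G) → (∀ v → f v ≤ Cover.size C v) → Colorable G C

module Submission where

-- (⇒) Given a cover (X, H) of G(D), read an edge of H between X_u and X_v
--     as an arc from X_u to X_v whenever uv is an arc of D.  As D is
--     bidirected, every edge of H becomes a pair of opposite arcs, so an
--     acyclic transversal of this digraph cover is independent in H: an
--     edge inside it would be a directed 2-cycle.
-- (⇐) Given a cover (X, H) of D, turn into an edge every arc of H that runs
--     from X_u to X_v with u of smaller index than v.  The matchings
--     survive, and in an independent transversal T of this graph cover
--     every arc of H[T] runs from larger to smaller index.  Hence H[T] is
--     acyclic: along a directed cycle the index would strictly decrease
--     all the way round.  This direction holds for every digraph.

open import Defs
open import Data.Nat using (ℕ; _<_; _≤_; s≤s; z≤n)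
open import Data.Nat.Properties using (<-irrefl; <-asym; <⇒≤; ≤-trans; <-≤-trans; <-cmp; ≤-refl)
open import Data.Fin using (Fin; toℕ)
open import Data.Fin.Properties using (toℕ-injective)
open import Data.List using ([]; _∷_; last)
open import Data.List.Relation.Unary.All using ([]; _∷_)
open import Data.List.Relation.Unary.AllPairs using ([]; _∷_)
open import Data.Maybe using (just)
open import Data.Maybe.Properties using (just-injective)
open import Data.Product using (Σ; _×_; _,_; proj₁; proj₂)
open import Data.Sum using (_⊎_; inj₁; inj₂)
open import Data.Empty using (⊥-elim)
open import Data.Unit using (tt)
open import Relation.Binary using (tri<; tri≈; tri>)
open import Relation.Binary.PropositionalEquality using (_≡_; _≢_; refl)
open import Relation.Nullary using (¬_)

module _ {m : ℕ} {R : Fin m → Fin m → Set} where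

  path-rank-≤ : (rank : Fin m → ℕ) → (∀ {u v} → R u v → rank v < rank u) →
                ∀ x xs {y} → DirPath R (x ∷ xs) → last (x ∷ xs) ≡ just y →
                rank y ≤ rank x
  path-rank-≤ rank desc x []       _       eq with just-injective eq
  ... | refl = ≤-refl
  path-rank-≤ rank desc x (z ∷ zs) (r , p) eq =
    ≤-trans (path-rank-≤ rank desc z zs p eq) (<⇒≤ (desc r))

  -- A relation along which some rank strictly decreases has no directed
  -- cycle: the closing arc would make the rank of the start exceed itself.
  descending⇒acyclic : (rank : Fin m → ℕ) → (∀ {u v} → R u v → rank v < rank u) →
                       ¬ HasDirCycle R
  descending⇒acyclic rank desc (x ∷ xs , _ , _ , p , y , last≡y , closing) =
    <-irrefl refl (<-≤-trans (desc closing) (path-rank-≤ rank desc x xs p last≡y))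

  two-cycle : ∀ {u v} → u ≢ v → R u v → R v u → HasDirCycle R
  two-cycle {u} {v} u≢v uv vu =
    u ∷ v ∷ [] , s≤s (s≤s z≤n) , (u≢v ∷ []) ∷ [] ∷ [] , (uv , tt) , v , refl , vu

arc⇒≢ : (D : Digraph) → ∀ {u v} → Arc D u v → u ≢ v
arc⇒≢ D {u} a refl = loopless D u a

orientCover : (D : Digraph) → Cover (underlying D) → DiCover D
orientCover D C = record
  { size         = Cover.size C
  ; HArc         = λ p q → HAdj C p q × Arc D (proj₁ p) (proj₁ q)
  ; H-loopless   = λ p h → H-irrefl C p (proj₁ h)
  ; independent  = λ v x y h → Cover.independent C v x y (proj₁ h)
  ; arcs-over    = λ u v x y h → proj₂ h
  ; matching-out = λ u v x y y′ a h h′ → matching-l C u v x y y′ (inj₁ a) (proj₁ h) (proj₁ h′)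
  ; matching-in  = λ u v x x′ y a h h′ → matching-r C u v x x′ y (inj₁ a) (proj₁ h) (proj₁ h′)
  }

-- For bidirected D, an acyclic transversal of the oriented cover is an
-- independent transversal of the original one: an edge inside it yields
-- two opposite arcs, i.e. a directed 2-cycle.
acyclic⇒independent : (D : Digraph) → IsBidirected D → (C : Cover (underlying D)) →
                      DiColorable D (orientCover D C) → Colorable (underlying D) C
acyclic⇒independent D bid C (t , acyclic) = t , no-edge
  where
  no-edge : ∀ u v → ¬ HAdj C (u , t u) (v , t v)
  no-edge u v h = acyclic (two-cycle (arc⇒≢ D uv) (h , uv) (H-sym C h , bid uv))
    where
    uv : Arc D u v
    uv with edges-over C u v (t u) (t v) h
    ... | inj₁ a = a
    ... | inj₂ a = bid a

module Unorient (D : Digraph) (C : DiCover D) where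

  Point : Set
  Point = Σ (Fin (n D)) (λ v → Fin (size C v))

  Upward : Point → Point → Set
  Upward (u , x) (v , y) =
    (toℕ u < toℕ v × HArc C (u , x) (v , y)) ⊎ (toℕ v < toℕ u × HArc C (v , y) (u , x))

  upward-apart : ∀ {u v x y} → Upward (u , x) (v , y) → u ≢ v
  upward-apart (inj₁ (lt , _)) refl = <-irrefl refl lt
  upward-apart (inj₂ (lt , _)) refl = <-irrefl refl lt

  -- Between X_u and X_v all upward edges come from arcs of one direction,
  -- so each matching of the new cover is one of the matchings of H.
  matching-l′ : ∀ u v (x : Fin (size C u)) (y y′ : Fin (size C v)) →
                Upward (u , x) (v , y) → Upward (u , x) (v , y′) → y ≡ y′
  matching-l′ u v x y y′ (inj₁ (_ , h)) (inj₁ (_ , h′)) = matching-out C u v x y y′ (arcs-over C u v x y h) h h′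
  matching-l′ u v x y y′ (inj₂ (_ , h)) (inj₂ (_ , h′)) = matching-in C v u y y′ x (arcs-over C v u y x h) h h′
  matching-l′ u v x y y′ (inj₁ (lt , _)) (inj₂ (gt , _)) = ⊥-elim (<-asym lt gt)
  matching-l′ u v x y y′ (inj₂ (gt , _)) (inj₁ (lt , _)) = ⊥-elim (<-asym lt gt)

  matching-r′ : ∀ u v (x x′ : Fin (size C u)) (y : Fin (size C v)) →
                Upward (u , x) (v , y) → Upward (u , x′) (v , y) → x ≡ x′
  matching-r′ u v x x′ y (inj₁ (_ , h)) (inj₁ (_ , h′)) = matching-in C u v x x′ y (arcs-over C u v x y h) h h′
  matching-r′ u v x x′ y (inj₂ (_ , h)) (inj₂ (_ , h′)) = matching-out C v u y x x′ (arcs-over C v u y x h) h h′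
  matching-r′ u v x x′ y (inj₁ (lt , _)) (inj₂ (gt , _)) = ⊥-elim (<-asym lt gt)
  matching-r′ u v x x′ y (inj₂ (gt , _)) (inj₁ (lt , _)) = ⊥-elim (<-asym lt gt)

  unorientCover : Cover (underlying D)
  unorientCover = record
    { size        = size C
    ; HAdj        = Upward
    ; H-irrefl    = λ p e → upward-apart e refl
    ; H-sym       = λ { (inj₁ e) → inj₂ e ; (inj₂ e) → inj₁ e }
    ; independent = λ v x y e → upward-apart e refl
    ; edges-over  = λ { u v x y (inj₁ (_ , h)) → inj₁ (arcs-over C u v x y h)
                      ; u v x y (inj₂ (_ , h)) → inj₂ (arcs-over C v u y x h) }
    ; matching-l  = λ u v x y y′ _ → matching-l′ u v x y y′
    ; matching-r  = λ u v x x′ y _ → matching-r′ u v x x′ y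
    }

  -- In an independent transversal of the unoriented cover every arc of
  -- H[T] goes downwards, so H[T] is acyclic with the index as rank.
  independent⇒acyclic : Colorable (underlying D) unorientCover → DiColorable D C
  independent⇒acyclic (t , independent-t) =
    t , descending⇒acyclic toℕ downwards
    where
    downwards : ∀ {u v} → HArc C (u , t u) (v , t v) → toℕ v < toℕ u
    downwards {u} {v} h with <-cmp (toℕ u) (toℕ v)
    ... | tri< lt _ _ = ⊥-elim (independent-t u v (inj₁ (lt , h)))
    ... | tri≈ _ eq _ = ⊥-elim (arc⇒≢ D (arcs-over C u v (t u) (t v) h) (toℕ-injective eq))
    ... | tri> _ _ gt = gt

open Unorient using (unorientCover; independent⇒acyclic)

theorem3 : (D : Digraph) → IsBidirected D → (f : Fin (n D) → ℕ) →
    (DP-f-colorableᴰ D f → DP-f-colorable (underlying D) f)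
    × (DP-f-colorable (underlying D) f → DP-f-colorableᴰ D f)
theorem3 D bid f = digraph⇒graph , graph⇒digraph
  where
  digraph⇒graph : DP-f-colorableᴰ D f → DP-f-colorable (underlying D) f
  digraph⇒graph colD C f≤size =
    acyclic⇒independent D bid C (colD (orientCover D C) f≤size)

  graph⇒digraph : DP-f-colorable (underlying D) f → DP-f-colorableᴰ D f
  graph⇒digraph colG C f≤size =
    independent⇒acyclic D C (colG (unorientCover D C) f≤size)
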